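{- Let $i$ be a positive integer and let $$a=2(i+1)i,\quad b=4(2i^2+4i+1)(2i+3)(2i+1),\quad c=2(4i+1)(4i+3)(4i^2+9i+4)(4i^2+7i+1).$$ Then $\{a,b,c\}$ is a $D(n)$-set for each of $n=n_1,n_2,n_3$, where \begin{align*} n_1&=1,\\ n_2&=512i^6+2560i^5+4832i^4+4352i^3+1980i^2+432i+36,\\ n_3&=65536i^{12}+655360i^{11}+2859008i^{10}+7151616i^9+11346176i^8+11932672i^7+8450112i^6\\ &\quad+4012672i^5+1249280i^4+243840i^3+27612i^2+1584i+36. \end{align*}
   Context: For a nonzero integer $n$, a $D(n)$-set is a set of distinct nonzero integers $\{a_1,\dots,a_m\}$ such that $a_ia_j+n$ is a perfect square for all $1\le i<j\le m$. -}

module Defs where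

open import Data.Integer using (ℤ; +_; _+_; _*_; _^_)
open import Data.List using (List; []; _∷_)
open import Data.List.Relation.Unary.All using (All)
open import Data.List.Relation.Unary.AllPairs using (AllPairs)
open import Data.Product using (∃; _×_)
open import Relation.Binary.PropositionalEquality using (_≡_)
open import Relation.Nullary using (¬_)

IsSquare : ℤ → Set
IsSquare x = ∃ λ (y : ℤ) → x ≡ y * y

-- A D(n)-set {a₁,…,aₘ} given as a list of its elements:
-- elements distinct and nonzero, and aᵢ aⱼ + n a square for all i < j.
-- (n is assumed nonzero by the caller.)
IsDSet : ℤ → List ℤ → Set
IsDSet n as =
  All (λ a → ¬ a ≡ + 0) as ×
  AllPairs (λ a b → ¬ a ≡ b) as ×
  AllPairs (λ a b → IsSquare (a * b + n)) as

aC bC cC : ℤ → ℤ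
aC i = + 2 * (i + + 1) * i
bC i = + 4 * (+ 2 * i ^ 2 + + 4 * i + + 1) * (+ 2 * i + + 3) * (+ 2 * i + + 1)
cC i = + 2 * (+ 4 * i + + 1) * (+ 4 * i + + 3) * (+ 4 * i ^ 2 + + 9 * i + + 4)
         * (+ 4 * i ^ 2 + + 7 * i + + 1)

n₁ n₂ n₃ : ℤ → ℤ
n₁ i = + 1
n₂ i = + 512 * i ^ 6 + + 2560 * i ^ 5 + + 4832 * i ^ 4 + + 4352 * i ^ 3
       + + 1980 * i ^ 2 + + 432 * i + + 36
n₃ i = + 65536 * i ^ 12 + + 655360 * i ^ 11 + + 2859008 * i ^ 10
       + + 7151616 * i ^ 9 + + 11346176 * i ^ 8 + + 11932672 * i ^ 7
       + + 8450112 * i ^ 6 + + 4012672 * i ^ 5 + + 1249280 * i ^ 4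
       + + 243840 * i ^ 3 + + 27612 * i ^ 2 + + 1584 * i + + 36

module Submission where

-- Every claim in Corollary 3 is a polynomial identity or inequality in i.
--
--  * Squares.  For each n ∈ {n₁, n₂, n₃} and each pair x, y of a, b, c
--    there is an explicit polynomial w with  x y + n = w²  identically in i.
--  * Distinctness.  The differences b − a, c − a and c − b are polynomials
--    in i with natural coefficients and positive constant term, so they are
--    positive for every natural i.
--  * Nonzero.  For i = m + 1 the values a, b, c evaluate to positive
--    integers by computation.
--
-- To check the identities cheaply we use proof by reflection: a small
-- language of univariate polynomial expressions, a normaliser into
-- coefficient lists, and its soundness theorem.  An identity then follows
-- once the normal form of the difference of both sides computes to zero,
-- and a positivity fact once the normal form has natural coefficients and
-- a positive constant term.

open import Defs
open import Data.Bool using (Bool; true; false; _∧_; T)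
open import Data.Integer using (ℤ; +_; _+_; _*_; -_; _^_)
open import Data.Integer.Properties using (+-identityˡ; *-zeroʳ; pos-*)
open import Data.Integer.Tactic.RingSolver using (solve-∀)
open import Data.List using (List; []; _∷_)
open import Data.List.Relation.Unary.All using ([]; _∷_)
open import Data.List.Relation.Unary.AllPairs using ([]; _∷_)
open import Data.Nat using (ℕ; zero; suc; _≥_)
import Data.Nat as ℕ
open import Data.Product using (∃; _×_; _,_)
open import Data.Unit using (tt)
open import Relation.Binary.PropositionalEquality
  using (_≡_; _≢_; refl; sym; trans; cong; cong₂; module ≡-Reasoning)

-- The constructors mirror the integer operations, so that an expression
-- written in the same shape as a definition of Defs denotes it definitionally.

infixl 6 _⊕_ _⊖_
infixl 7 _⊗_
infixl 8 _⊛_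

data Expr : Set where
  I       : Expr
  con     : ℤ → Expr
  _⊕_ _⊗_ : Expr → Expr → Expr
  _⊛_     : Expr → ℕ → Expr

⟦_⟧ : Expr → ℤ → ℤ
⟦ I ⟧     x = x
⟦ con c ⟧ x = c
⟦ e ⊕ f ⟧ x = ⟦ e ⟧ x + ⟦ f ⟧ x
⟦ e ⊗ f ⟧ x = ⟦ e ⟧ x * ⟦ f ⟧ x
⟦ e ⊛ k ⟧ x = ⟦ e ⟧ x ^ k

lit : ℕ → Expr
lit n = con (+ n)

_⊖_ : Expr → Expr → Expr
e ⊖ f = e ⊕ con (- + 1) ⊗ f

horner : List ℕ → Expr
horner []       = lit 0
horner (c ∷ cs) = lit c ⊕ I ⊗ horner cs

Poly : Set
Poly = List ℤ

eval : Poly → ℤ → ℤ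
eval []      x = + 0
eval (c ∷ p) x = c + x * eval p x

_+ᴾ_ : Poly → Poly → Poly
[]      +ᴾ q       = q
(c ∷ p) +ᴾ []      = c ∷ p
(c ∷ p) +ᴾ (d ∷ q) = c + d ∷ p +ᴾ q

scale : ℤ → Poly → Poly
scale c []      = []
scale c (d ∷ p) = c * d ∷ scale c p

_*ᴾ_ : Poly → Poly → Poly
[]      *ᴾ q = []
(c ∷ p) *ᴾ q = scale c q +ᴾ (+ 0 ∷ p *ᴾ q)

_^ᴾ_ : Poly → ℕ → Poly
p ^ᴾ zero  = + 1 ∷ []
p ^ᴾ suc k = p *ᴾ (p ^ᴾ k)

normalise : Expr → Poly
normalise I       = + 0 ∷ + 1 ∷ []
normalise (con c) = c ∷ []
normalise (e ⊕ f) = normalise e +ᴾ normalise f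
normalise (e ⊗ f) = normalise e *ᴾ normalise f
normalise (e ⊛ k) = normalise e ^ᴾ k

+ᴾ-sound : ∀ p q x → eval (p +ᴾ q) x ≡ eval p x + eval q x
+ᴾ-sound []      q       x = sym (+-identityˡ _)
+ᴾ-sound (c ∷ p) []      x = step (c + x * eval p x)
  where
  step : ∀ u → u ≡ u + + 0
  step = solve-∀
+ᴾ-sound (c ∷ p) (d ∷ q) x =
  trans (cong (λ s → c + d + x * s) (+ᴾ-sound p q x)) (step c d x (eval p x) (eval q x))
  where
  step : ∀ c d x u v → c + d + x * (u + v) ≡ c + x * u + (d + x * v)
  step = solve-∀

scale-sound : ∀ c p x → eval (scale c p) x ≡ c * eval p x
scale-sound c []      x = sym (*-zeroʳ c)
scale-sound c (d ∷ p) x =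
  trans (cong (λ s → c * d + x * s) (scale-sound c p x)) (step c d x (eval p x))
  where
  step : ∀ c d x u → c * d + x * (c * u) ≡ c * (d + x * u)
  step = solve-∀

*ᴾ-sound : ∀ p q x → eval (p *ᴾ q) x ≡ eval p x * eval q x
*ᴾ-sound []      q x = refl
*ᴾ-sound (c ∷ p) q x = begin
  eval (scale c q +ᴾ (+ 0 ∷ p *ᴾ q)) x          ≡⟨ +ᴾ-sound (scale c q) (+ 0 ∷ p *ᴾ q) x ⟩
  eval (scale c q) x + (+ 0 + x * eval (p *ᴾ q) x)
    ≡⟨ cong₂ (λ s t → s + (+ 0 + x * t)) (scale-sound c q x) (*ᴾ-sound p q x) ⟩
  c * eval q x + (+ 0 + x * (eval p x * eval q x)) ≡⟨ step c x (eval p x) (eval q x) ⟩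
  (c + x * eval p x) * eval q x                    ∎
  where
  open ≡-Reasoning
  step : ∀ c x u v → c * v + (+ 0 + x * (u * v)) ≡ (c + x * u) * v
  step = solve-∀

^ᴾ-sound : ∀ p k x → eval (p ^ᴾ k) x ≡ eval p x ^ k
^ᴾ-sound p zero    x = step x
  where
  step : ∀ x → + 1 + x * + 0 ≡ + 1
  step = solve-∀
^ᴾ-sound p (suc k) x =
  trans (*ᴾ-sound p (p ^ᴾ k) x) (cong (eval p x *_) (^ᴾ-sound p k x))

normalise-sound : ∀ e x → eval (normalise e) x ≡ ⟦ e ⟧ x
normalise-sound I       x = step x
  where
  step : ∀ x → + 0 + x * (+ 1 + x * + 0) ≡ x
  step = solve-∀
normalise-sound (con c) x = step c x
  where
  step : ∀ c x → c + x * + 0 ≡ c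
  step = solve-∀
normalise-sound (e ⊕ f) x =
  trans (+ᴾ-sound (normalise e) (normalise f) x)
        (cong₂ _+_ (normalise-sound e x) (normalise-sound f x))
normalise-sound (e ⊗ f) x =
  trans (*ᴾ-sound (normalise e) (normalise f) x)
        (cong₂ _*_ (normalise-sound e x) (normalise-sound f x))
normalise-sound (e ⊛ k) x =
  trans (^ᴾ-sound (normalise e) k x) (cong (_^ k) (normalise-sound e x))

difference-sound : ∀ e f x → eval (normalise (e ⊖ f)) x ≡ ⟦ e ⟧ x + - + 1 * ⟦ f ⟧ x
difference-sound e f x = normalise-sound (e ⊖ f) x

IsZero IsNatural IsPositive : ℤ → Bool
IsZero (+ zero) = true
IsZero _        = false
IsNatural (+ _) = true
IsNatural _     = false
IsPositive (+ suc _) = true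
IsPositive _         = false

AllZero NaturalCoeffs PositivePoly : Poly → Bool
AllZero []      = true
AllZero (c ∷ p) = IsZero c ∧ AllZero p
NaturalCoeffs []      = true
NaturalCoeffs (c ∷ p) = IsNatural c ∧ NaturalCoeffs p
PositivePoly []      = false
PositivePoly (c ∷ p) = IsPositive c ∧ NaturalCoeffs p

allZero-eval : ∀ p x → T (AllZero p) → eval p x ≡ + 0
allZero-eval []           x _ = refl
allZero-eval (+ zero ∷ p) x z =
  trans (+-identityˡ _) (trans (cong (x *_) (allZero-eval p x z)) (*-zeroʳ x))

eval-step : ∀ c p k n → eval p (+ k) ≡ + n → eval (+ c ∷ p) (+ k) ≡ + (c ℕ.+ k ℕ.* n)
eval-step c p k n eq = cong (λ s → + c + s) (trans (cong (+ k *_) eq) (sym (pos-* k n)))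

natural-eval : ∀ p k → T (NaturalCoeffs p) → ∃ λ n → eval p (+ k) ≡ + n
natural-eval []        k _ = 0 , refl
natural-eval (+ c ∷ p) k h with natural-eval p k h
... | n , eq = c ℕ.+ k ℕ.* n , eval-step c p k n eq

positive-eval : ∀ p k → T (PositivePoly p) → ∃ λ n → eval p (+ k) ≡ + suc n
positive-eval (+ suc c ∷ p) k h with natural-eval p k h
... | n , eq = c ℕ.+ k ℕ.* n , eval-step (suc c) p k n eq

identity : ∀ e f → T (AllZero (normalise (e ⊖ f))) → ∀ x → ⟦ e ⟧ x ≡ ⟦ f ⟧ x
identity e f z x = cancel (⟦ e ⟧ x) (⟦ f ⟧ x)
  (trans (sym (difference-sound e f x)) (allZero-eval (normalise (e ⊖ f)) x z))
  where
  cancel : ∀ u v → u + - + 1 * v ≡ + 0 → u ≡ v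
  cancel u v d = trans (shift u v) (trans (cong (_+ v) d) (+-identityˡ v))
    where
    shift : ∀ u v → u ≡ u + - + 1 * v + v
    shift = solve-∀

separated : ∀ e f → T (PositivePoly (normalise (f ⊖ e))) → ∀ k → ⟦ e ⟧ (+ k) ≢ ⟦ f ⟧ (+ k)
separated e f pos k e≡f with positive-eval (normalise (f ⊖ e)) k pos
... | n , gap = zero≢positive (begin
  + 0                             ≡⟨ sym (self-difference (⟦ f ⟧ x)) ⟩
  ⟦ f ⟧ x + - + 1 * ⟦ f ⟧ x       ≡⟨ cong (λ v → ⟦ f ⟧ x + - + 1 * v) (sym e≡f) ⟩
  ⟦ f ⟧ x + - + 1 * ⟦ e ⟧ x       ≡⟨ sym (difference-sound f e x) ⟩
  eval (normalise (f ⊖ e)) x      ≡⟨ gap ⟩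
  + suc n                         ∎)
  where
  open ≡-Reasoning
  x : ℤ
  x = + k
  zero≢positive : + 0 ≢ + suc n
  zero≢positive ()
  self-difference : ∀ u → u + - + 1 * u ≡ + 0
  self-difference = solve-∀

-- The triple and the three values of n as expressions, written in exactly
-- the shape of their definitions, so that ⟦ A ⟧ i is aC i by computation, etc.
A B C N₁ N₂ N₃ : Expr
A = lit 2 ⊗ (I ⊕ lit 1) ⊗ I
B = lit 4 ⊗ (lit 2 ⊗ I ⊛ 2 ⊕ lit 4 ⊗ I ⊕ lit 1) ⊗ (lit 2 ⊗ I ⊕ lit 3) ⊗ (lit 2 ⊗ I ⊕ lit 1)
C = lit 2 ⊗ (lit 4 ⊗ I ⊕ lit 1) ⊗ (lit 4 ⊗ I ⊕ lit 3) ⊗ (lit 4 ⊗ I ⊛ 2 ⊕ lit 9 ⊗ I ⊕ lit 4)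
      ⊗ (lit 4 ⊗ I ⊛ 2 ⊕ lit 7 ⊗ I ⊕ lit 1)
N₁ = lit 1
N₂ = lit 512 ⊗ I ⊛ 6 ⊕ lit 2560 ⊗ I ⊛ 5 ⊕ lit 4832 ⊗ I ⊛ 4 ⊕ lit 4352 ⊗ I ⊛ 3
     ⊕ lit 1980 ⊗ I ⊛ 2 ⊕ lit 432 ⊗ I ⊕ lit 36
N₃ = lit 65536 ⊗ I ⊛ 12 ⊕ lit 655360 ⊗ I ⊛ 11 ⊕ lit 2859008 ⊗ I ⊛ 10
     ⊕ lit 7151616 ⊗ I ⊛ 9 ⊕ lit 11346176 ⊗ I ⊛ 8 ⊕ lit 11932672 ⊗ I ⊛ 7
     ⊕ lit 8450112 ⊗ I ⊛ 6 ⊕ lit 4012672 ⊗ I ⊛ 5 ⊕ lit 1249280 ⊗ I ⊛ 4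
     ⊕ lit 243840 ⊗ I ⊛ 3 ⊕ lit 27612 ⊗ I ⊛ 2 ⊕ lit 1584 ⊗ I ⊕ lit 36

square-by : ∀ X Y N (ws : List ℕ) →
            T (AllZero (normalise (X ⊗ Y ⊕ N ⊖ horner ws ⊗ horner ws))) →
            ∀ i → IsSquare (⟦ X ⟧ i * ⟦ Y ⟧ i + ⟦ N ⟧ i)
square-by X Y N ws z i = ⟦ horner ws ⟧ i , identity (X ⊗ Y ⊕ N) (horner ws ⊗ horner ws) z i

Squares : (ℤ → ℤ) → Set
Squares n = ∀ i → IsSquare (aC i * bC i + n i)
                × IsSquare (aC i * cC i + n i)
                × IsSquare (bC i * cC i + n i)

squares₁ : Squares n₁
squares₁ i = square-by A B N₁ (1 ∷ 12 ∷ 20 ∷ 8 ∷ []) tt i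
           , square-by A C N₁ (1 ∷ 24 ∷ 86 ∷ 96 ∷ 32 ∷ []) tt i
           , square-by B C N₁ (17 ∷ 180 ∷ 628 ∷ 920 ∷ 576 ∷ 128 ∷ []) tt i

squares₂ : Squares n₂
squares₂ i = square-by A B N₂ (6 ∷ 38 ∷ 60 ∷ 24 ∷ []) tt i
           , square-by A C N₂ (6 ∷ 40 ∷ 94 ∷ 96 ∷ 32 ∷ []) tt i
           , square-by B C N₂ (18 ∷ 182 ∷ 628 ∷ 920 ∷ 576 ∷ 128 ∷ []) tt i

squares₃ : Squares n₃
squares₃ i = square-by A B N₃ (6 ∷ 134 ∷ 820 ∷ 2048 ∷ 2384 ∷ 1280 ∷ 256 ∷ []) tt i
           , square-by A C N₃ (6 ∷ 136 ∷ 822 ∷ 2048 ∷ 2384 ∷ 1280 ∷ 256 ∷ []) tt i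
           , square-by B C N₃ (18 ∷ 214 ∷ 988 ∷ 2176 ∷ 2416 ∷ 1280 ∷ 256 ∷ []) tt i

-- a < b < c at every natural i: the differences b − a, c − a, c − b are
-- 12 + 78i + …, 24 + 348i + … and 12 + 270i + …, with natural coefficients.
distinct : ∀ k → aC (+ k) ≢ bC (+ k) × aC (+ k) ≢ cC (+ k) × bC (+ k) ≢ cC (+ k)
distinct k = separated A B tt k , separated A C tt k , separated B C tt k

three-element-DSet : ∀ {n a b c} → a ≢ + 0 → b ≢ + 0 → c ≢ + 0 →
                     a ≢ b × a ≢ c × b ≢ c →
                     IsSquare (a * b + n) × IsSquare (a * c + n) × IsSquare (b * c + n) →
                     IsDSet n (a ∷ b ∷ c ∷ [])
three-element-DSet a≢0 b≢0 c≢0 (a≢b , a≢c , b≢c) (ab , ac , bc) =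
  (a≢0 ∷ b≢0 ∷ c≢0 ∷ []) ,
  ((a≢b ∷ a≢c ∷ []) ∷ (b≢c ∷ []) ∷ [] ∷ []) ,
  ((ab ∷ ac ∷ []) ∷ (bc ∷ []) ∷ [] ∷ [])

-- At i = m + 1 the triple is a D(n)-set whenever the products are squares;
-- a, b, c are nonzero there because they compute to positive integers.
triple-DSet : ∀ n → Squares n → ∀ m →
              IsDSet (n (+ suc m)) (aC (+ suc m) ∷ bC (+ suc m) ∷ cC (+ suc m) ∷ [])
triple-DSet n squares m =
  three-element-DSet (λ ()) (λ ()) (λ ()) (distinct (suc m)) (squares (+ suc m))

corollary3 : (k : ℕ) → k ≥ 1 →
    IsDSet (n₁ (+ k)) (aC (+ k) ∷ bC (+ k) ∷ cC (+ k) ∷ [])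
    × IsDSet (n₂ (+ k)) (aC (+ k) ∷ bC (+ k) ∷ cC (+ k) ∷ [])
    × IsDSet (n₃ (+ k)) (aC (+ k) ∷ bC (+ k) ∷ cC (+ k) ∷ [])
corollary3 (suc m) _ =
  triple-DSet n₁ squares₁ m , triple-DSet n₂ squares₂ m , triple-DSet n₃ squares₃ m
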